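{- For all integers $r,n \geq 1$, \[ a_r(r,n) = 2a_r(r,n-1) + a_{r-1}(r-1,n). \]
   Context: For integers $r \geq 0$ and $n \geq 0$, $a(r,n)$ is the number of ways to tile a $1 \times (n+r)$ grid using $r$ indistinguishable red $1\times1$ squares and white tiles of arbitrary positive integer lengths of total length $n$ (tiles cover the grid, meet only on boundaries, and order matters); $a(r,n)=0$ for $n<0$. Define $a_0(r,n)=a(r,n)$ and, for $s\geq 1$, $a_s(r,n)=\sum_{i=0}^n a_{s-1}(r,i)$ (and $0$ for $n<0$). -}

module Defs where

open import Data.Nat using (ℕ; zero; suc; _+_; _∸_; _≟_)
open import Data.List using (List; []; _∷_; [_]; map; _++_; concatMap; upTo; length; filter)
open import Data.Nat.ListAction using (sum)
open import Data.Bool using (Bool; true; false)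

-- A tile: a red 1×1 square, or a white tile of length (suc k) (positive length).
data Tile : Set where
  red   : Tile
  white : ℕ → Tile

reds : List Tile → ℕ
reds []            = 0
reds (red ∷ t)     = suc (reds t)
reds (white _ ∷ t) = reds t

-- gen f L: all (ordered) tilings of a 1×L grid by red squares and white tiles
-- of arbitrary positive length (f is structural fuel; f ≥ L suffices).
gen : ℕ → ℕ → List (List Tile)
gen _       zero    = [ [] ]
gen zero    (suc L) = []
gen (suc f) (suc L) =
  map (red ∷_) (gen f L)
  ++ concatMap (λ k → map (white k ∷_) (gen f (L ∸ k))) (upTo (suc L))

-- a(r,n): number of tilings of the 1×(n+r) grid using exactly r red squares
-- (so the white tiles have total length n).
a : ℕ → ℕ → ℕ
a r n = length (filter (λ t → reds t ≟ r) (gen (n + r) (n + r)))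

aS : ℕ → ℕ → ℕ → ℕ
aS zero    r n = a r n
aS (suc s) r n = sum (map (aS s r) (upTo (suc n)))

module Submission where

-- Splitting a tiling with r+1 reds by its first tile (red, or white followed by a shorter
-- tiling) gives a(r+1,0) = a(r,0) and a(r+1,n+1) = a(r,n+1) + Σ_{i≤n} a(r+1,i); equivalently
-- F = a_1(r+1,·) satisfies F(n+1) = 2F(n) + H(n+1), F(0) = H(0), with H = a_0(r,·).
-- Taking prefix sums of F and H simultaneously preserves this recurrence, so it passes from
-- (a_1(r+1,·), a_0(r,·)) to (a_{s+1}(r+1,·), a_s(r,·)) for every s.

open import Defs
open import Data.Nat using (ℕ; zero; suc; _+_; _*_; _∸_; _≤_; _<_; _≟_; s≤s; _≤′_; ≤′-refl; ≤′-step)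
open import Data.Nat.Properties using (+-suc; +-comm; +-identityʳ; ≤-trans; m∸n≤m; n≤1+n; n<1+n; ≤⇒≤′; ≤′⇒≤)
open import Data.Nat.ListAction using (sum)
open import Data.Nat.ListAction.Properties using (sum-++)
open import Data.Nat.Tactic.RingSolver using (solve-∀)
open import Function using (_∘_)
open import Data.List using (List; []; _∷_; [_]; map; _++_; concatMap; upTo; length; filter)
open import Data.List.Properties using (filter-++; length-++; concatMap-cong; map-applyUpTo; map-upTo; upTo-∷ʳ; map-++; map-cong)
open import Data.Product using (_×_; _,_; proj₂)
open import Data.Bool using (true; false)
open import Relation.Nullary using (does)
open import Relation.Binary.PropositionalEquality using (_≡_; refl; sym; trans; cong; cong₂; module ≡-Reasoning)

prefixSum : (ℕ → ℕ) → ℕ → ℕ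
prefixSum f n = sum (map f (upTo (suc n)))

prefixSum-zero : ∀ f → prefixSum f 0 ≡ f 0
prefixSum-zero f = +-identityʳ (f 0)

prefixSum-suc : ∀ f n → prefixSum f (suc n) ≡ prefixSum f n + f (suc n)
prefixSum-suc f n = begin
  sum (map f (upTo (suc (suc n))))          ≡⟨ cong (sum ∘ map f) (upTo-∷ʳ (suc n)) ⟨
  sum (map f (upTo (suc n) ++ [ suc n ]))   ≡⟨ cong sum (map-++ f (upTo (suc n)) [ suc n ]) ⟩
  sum (map f (upTo (suc n)) ++ [ f (suc n) ]) ≡⟨ sum-++ (map f (upTo (suc n))) [ f (suc n) ] ⟩
  prefixSum f n + (f (suc n) + 0)           ≡⟨ cong (prefixSum f n +_) (+-identityʳ (f (suc n))) ⟩
  prefixSum f n + f (suc n)                 ∎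
  where open ≡-Reasoning

DoublingRecurrence : (ℕ → ℕ) → (ℕ → ℕ) → Set
DoublingRecurrence F H = F 0 ≡ H 0 × (∀ n → F (suc n) ≡ 2 * F n + H (suc n))

prefixSum-doubling : ∀ {F H} → DoublingRecurrence F H → DoublingRecurrence (prefixSum F) (prefixSum H)
prefixSum-doubling {F} {H} (base , step) = cong (_+ 0) base , step′
  where
  open ≡-Reasoning
  x+[2x+y]≡2x+[x+y] : ∀ x y → x + (2 * x + y) ≡ 2 * x + (x + y)
  x+[2x+y]≡2x+[x+y] = solve-∀
  [2x+y]+[2u+v]≡2[x+u]+[y+v] : ∀ x y u v → (2 * x + y) + (2 * u + v) ≡ 2 * (x + u) + (y + v)
  [2x+y]+[2u+v]≡2[x+u]+[y+v] = solve-∀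

  step′ : ∀ n → prefixSum F (suc n) ≡ 2 * prefixSum F n + prefixSum H (suc n)
  step′ zero = begin
    prefixSum F 1                               ≡⟨ prefixSum-suc F 0 ⟩
    prefixSum F 0 + F 1                         ≡⟨ cong₂ _+_ (prefixSum-zero F) (step 0) ⟩
    F 0 + (2 * F 0 + H 1)                       ≡⟨ x+[2x+y]≡2x+[x+y] (F 0) (H 1) ⟩
    2 * F 0 + (F 0 + H 1)                       ≡⟨ cong₂ (λ x y → 2 * x + (y + H 1))
                                                     (prefixSum-zero F) (trans (prefixSum-zero H) (sym base)) ⟨
    2 * prefixSum F 0 + (prefixSum H 0 + H 1)   ≡⟨ cong (2 * prefixSum F 0 +_) (prefixSum-suc H 0) ⟨
    2 * prefixSum F 0 + prefixSum H 1           ∎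
  step′ (suc n) = begin
    prefixSum F (suc (suc n))
      ≡⟨ prefixSum-suc F (suc n) ⟩
    prefixSum F (suc n) + F (suc (suc n))
      ≡⟨ cong₂ _+_ (step′ n) (step (suc n)) ⟩
    (2 * prefixSum F n + prefixSum H (suc n)) + (2 * F (suc n) + H (suc (suc n)))
      ≡⟨ [2x+y]+[2u+v]≡2[x+u]+[y+v] (prefixSum F n) (prefixSum H (suc n)) (F (suc n)) _ ⟩
    2 * (prefixSum F n + F (suc n)) + (prefixSum H (suc n) + H (suc (suc n)))
      ≡⟨ cong₂ (λ x y → 2 * x + y) (prefixSum-suc F n) (prefixSum-suc H (suc n)) ⟨
    2 * prefixSum F (suc n) + prefixSum H (suc (suc n)) ∎

gen-suc-fuel : ∀ {f L} → L ≤ f → gen (suc f) L ≡ gen f L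
gen-suc-fuel {L = zero} _ = refl
gen-suc-fuel {suc f} {suc L} (s≤s L≤f) =
  cong₂ _++_ (cong (map (red ∷_)) (gen-suc-fuel L≤f))
             (concatMap-cong (λ k → cong (map (white k ∷_)) (gen-suc-fuel (≤-trans (m∸n≤m L k) L≤f)))
               (upTo (suc L)))

gen-fuel : ∀ {f L} → L ≤′ f → gen f L ≡ gen L L
gen-fuel ≤′-refl        = refl
gen-fuel (≤′-step L≤′f) = trans (gen-suc-fuel (≤′⇒≤ L≤′f)) (gen-fuel L≤′f)

tilings : ℕ → List (List Tile)
tilings L = gen L L

tilings-suc : ∀ L → tilings (suc L) ≡
  map (red ∷_) (tilings L) ++ concatMap (λ k → map (white k ∷_) (tilings (L ∸ k))) (upTo (suc L))
tilings-suc L = cong (map (red ∷_) (tilings L) ++_)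
  (concatMap-cong (λ k → cong (map (white k ∷_)) (gen-fuel (≤⇒≤′ (m∸n≤m L k)))) (upTo (suc L)))

countReds : ℕ → List (List Tile) → ℕ
countReds r ts = length (filter (λ t → reds t ≟ r) ts)

countReds-++ : ∀ r ts us → countReds r (ts ++ us) ≡ countReds r ts + countReds r us
countReds-++ r ts us =
  trans (cong length (filter-++ (λ t → reds t ≟ r) ts us)) (length-++ (filter (λ t → reds t ≟ r) ts))

-- Phrased with `does` so that the instances for `red ∷_` and `white k ∷_` hold by computation.
countReds-map : ∀ {r s} (f : List Tile → List Tile) →
  (∀ t → does (reds (f t) ≟ r) ≡ does (reds t ≟ s)) →
  ∀ ts → countReds r (map f ts) ≡ countReds s ts
countReds-map f same [] = refl
countReds-map {r} {s} f same (t ∷ ts) with does (reds (f t) ≟ r) | does (reds t ≟ s) | same t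
... | true  | true  | refl = cong suc (countReds-map f same ts)
... | false | false | refl = countReds-map f same ts

countReds-concatMap : ∀ r (h : ℕ → List (List Tile)) ks →
  countReds r (concatMap h ks) ≡ sum (map (λ k → countReds r (h k)) ks)
countReds-concatMap r h []       = refl
countReds-concatMap r h (k ∷ ks) =
  trans (countReds-++ r (h k) (concatMap h ks)) (cong (countReds r (h k) +_) (countReds-concatMap r h ks))

tilingCount : ℕ → ℕ → ℕ
tilingCount L r = countReds r (tilings L)

-- The tilings of length L+1 with r reds whose first tile is white: white k has length k+1.
whiteFirstCount : ℕ → ℕ → ℕ
whiteFirstCount L r = sum (map (λ k → tilingCount (L ∸ k) r) (upTo (suc L)))

tilingCount-suc : ∀ L r → tilingCount (suc L) (suc r) ≡ tilingCount L r + whiteFirstCount L (suc r)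
tilingCount-suc L r = begin
  countReds (suc r) (tilings (suc L))
    ≡⟨ cong (countReds (suc r)) (tilings-suc L) ⟩
  countReds (suc r) (map (red ∷_) (tilings L) ++ concatMap whiteFirst (upTo (suc L)))
    ≡⟨ countReds-++ (suc r) (map (red ∷_) (tilings L)) (concatMap whiteFirst (upTo (suc L))) ⟩
  countReds (suc r) (map (red ∷_) (tilings L)) + countReds (suc r) (concatMap whiteFirst (upTo (suc L)))
    ≡⟨ cong₂ _+_ (countReds-map (red ∷_) (λ _ → refl) (tilings L))
                 (countReds-concatMap (suc r) whiteFirst (upTo (suc L))) ⟩
  tilingCount L r + sum (map (λ k → countReds (suc r) (whiteFirst k)) (upTo (suc L)))
    ≡⟨ cong (λ ts → tilingCount L r + sum ts)
         (map-cong (λ k → countReds-map (white k ∷_) (λ _ → refl) (tilings (L ∸ k))) (upTo (suc L))) ⟩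
  tilingCount L r + whiteFirstCount L (suc r) ∎
  where
  open ≡-Reasoning
  whiteFirst : ℕ → List (List Tile)
  whiteFirst k = map (white k ∷_) (tilings (L ∸ k))

whiteFirstCount-suc : ∀ L r → whiteFirstCount (suc L) r ≡ tilingCount (suc L) r + whiteFirstCount L r
whiteFirstCount-suc L r = cong (tilingCount (suc L) r +_) (trans
  (cong sum (map-applyUpTo suc (λ k → tilingCount (suc L ∸ k) r) (suc L)))
  (sym (cong sum (map-upTo (λ k → tilingCount (L ∸ k) r) (suc L)))))

mutual
  tilingCount-< : ∀ {L r} → L < r → tilingCount L r ≡ 0
  tilingCount-< {zero}  {suc r} _         = refl
  tilingCount-< {suc L} {suc r} (s≤s L<r) = trans (tilingCount-suc L r)
    (cong₂ _+_ (tilingCount-< L<r) (whiteFirstCount-< (≤-trans L<r (n≤1+n r))))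

  whiteFirstCount-< : ∀ {L r} → L < r → whiteFirstCount L r ≡ 0
  whiteFirstCount-< {zero}  L<r = cong (_+ 0) (tilingCount-< L<r)
  whiteFirstCount-< {suc L} L<r = trans (whiteFirstCount-suc L _)
    (cong₂ _+_ (tilingCount-< L<r) (whiteFirstCount-< (≤-trans (n≤1+n (suc L)) L<r)))

a-suc-reds : ∀ r n → a (suc r) n ≡ tilingCount (suc (n + r)) (suc r)
a-suc-reds r n = cong (λ L → tilingCount L (suc r)) (+-suc n r)

whiteFirstCount-prefixSum : ∀ r n → whiteFirstCount (suc (n + r)) (suc r) ≡ prefixSum (a (suc r)) n
whiteFirstCount-prefixSum r zero = trans (whiteFirstCount-suc r (suc r))
  (cong (tilingCount (suc r) (suc r) +_) (whiteFirstCount-< (n<1+n r)))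
whiteFirstCount-prefixSum r (suc n) = begin
  whiteFirstCount (suc (suc n + r)) (suc r)
    ≡⟨ whiteFirstCount-suc (suc n + r) (suc r) ⟩
  tilingCount (suc (suc n + r)) (suc r) + whiteFirstCount (suc (n + r)) (suc r)
    ≡⟨ cong₂ _+_ (sym (a-suc-reds r (suc n))) (whiteFirstCount-prefixSum r n) ⟩
  a (suc r) (suc n) + prefixSum (a (suc r)) n
    ≡⟨ +-comm (a (suc r) (suc n)) (prefixSum (a (suc r)) n) ⟩
  prefixSum (a (suc r)) n + a (suc r) (suc n)
    ≡⟨ prefixSum-suc (a (suc r)) n ⟨
  prefixSum (a (suc r)) (suc n) ∎
  where open ≡-Reasoning

a-suc-zero : ∀ r → a (suc r) 0 ≡ a r 0
a-suc-zero r = trans (tilingCount-suc r r)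
  (trans (cong (a r 0 +_) (whiteFirstCount-< (n<1+n r))) (+-identityʳ (a r 0)))

a-suc-suc : ∀ r n → a (suc r) (suc n) ≡ a r (suc n) + prefixSum (a (suc r)) n
a-suc-suc r n = trans (a-suc-reds r (suc n))
  (trans (tilingCount-suc (suc (n + r)) r) (cong (a r (suc n) +_) (whiteFirstCount-prefixSum r n)))

prefixSum-a-doubling : ∀ r → DoublingRecurrence (prefixSum (a (suc r))) (a r)
prefixSum-a-doubling r = trans (prefixSum-zero (a (suc r))) (a-suc-zero r) , step
  where
  open ≡-Reasoning
  S : ℕ → ℕ
  S = prefixSum (a (suc r))
  x+[y+x]≡2x+y : ∀ x y → x + (y + x) ≡ 2 * x + y
  x+[y+x]≡2x+y = solve-∀

  step : ∀ n → S (suc n) ≡ 2 * S n + a r (suc n)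
  step n = begin
    S (suc n)                       ≡⟨ prefixSum-suc (a (suc r)) n ⟩
    S n + a (suc r) (suc n)         ≡⟨ cong (S n +_) (a-suc-suc r n) ⟩
    S n + (a r (suc n) + S n)       ≡⟨ x+[y+x]≡2x+y (S n) (a r (suc n)) ⟩
    2 * S n + a r (suc n)           ∎

aS-doubling : ∀ s r → DoublingRecurrence (aS (suc s) (suc r)) (aS s r)
aS-doubling zero    r = prefixSum-a-doubling r
aS-doubling (suc s) r = prefixSum-doubling {aS (suc s) (suc r)} {aS s r} (aS-doubling s r)

mainTheorem4 : (r n : ℕ) → 1 ≤ r → 1 ≤ n →
    aS r r n ≡ 2 * aS r r (n ∸ 1) + aS (r ∸ 1) (r ∸ 1) n
mainTheorem4 (suc r) (suc n) _ _ = proj₂ (aS-doubling r r) n
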